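{- Let $X=\{1,\dots,r\}$, $k\ge1$ and $\pi\in\mathbb S_r$. The number of semirigid $\mathbf P\in\mathcal{PP}_k(X\times X)$ with $\mathbf P\pi=\mathbf P$ is at most $\left\{ {\beta(\pi)+1 \atop k+1} \right\}$.
   Context: $\mathcal{PP}_k(X\times X)$ is the set of partial partitions of $X\times X$ into $k$ parts (families of $k$ pairwise disjoint non-empty subsets). $\mathbb S_r$ acts on $X\times X$ by $(x,y)\sigma=(x\sigma,y\sigma)$ and on partial partitions blockwise. $\mathbf P=\{P_1,\dots,P_k\}$ is semirigid if every $\sigma\in\mathbb S_r$ with $\mathbf P\sigma=\mathbf P$ satisfies $P_i\sigma=P_i$ for all $i$. $\beta(\pi)$ is the number of orbits of $\langle\pi\rangle$ on $X\times X$. $\left\{ {a \atop b} \right\}$ is the Stirling number of the second kind. -}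

module Defs where

open import Data.Nat using (ℕ; zero; suc; _+_; _*_)
open import Data.Fin using (Fin)
open import Data.Fin.Permutation using (Permutation′; _⟨$⟩ʳ_; _⟨$⟩ˡ_)
open import Data.Bool using (Bool; true; false)
open import Data.Vec using (Vec; lookup; tabulate)
open import Data.List using (List; map; length)
open import Data.List.Relation.Unary.All using (All)
open import Data.List.Relation.Unary.AllPairs using (AllPairs)
open import Data.List.Relation.Binary.Permutation.Propositional using (_↭_)
open import Data.Product using (_×_; _,_; ∃; Σ)
open import Data.Sum using (_⊎_)
open import Function using (_∘_)
open import Relation.Nullary using (¬_)
open import Relation.Binary.PropositionalEquality using (_≡_)

S : ℕ → ℕ → ℕ
S zero    zero    = 1
S zero    (suc k) = 0
S (suc n) zero    = 0
S (suc n) (suc k) = suc k * S n (suc k) + S n k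

Pt : ℕ → Set
Pt r = Fin r × Fin r

SubXX : ℕ → Set
SubXX r = Vec (Vec Bool r) r

_∈XX_ : ∀ {r} → Pt r → SubXX r → Set
(x , y) ∈XX A = lookup (lookup A x) y ≡ true

NonEmpty : ∀ {r} → SubXX r → Set
NonEmpty {r} A = ∃ λ (p : Pt r) → p ∈XX A

Disjoint : ∀ {r} → SubXX r → SubXX r → Set
Disjoint {r} A B = (p : Pt r) → p ∈XX A → p ∈XX B → Data.Empty.⊥
  where import Data.Empty

actPt : ∀ {r} → Permutation′ r → Pt r → Pt r
actPt σ (x , y) = (σ ⟨$⟩ʳ x , σ ⟨$⟩ʳ y)

-- A σ = { p σ | p ∈ A },  i.e.  (u,v) ∈ Aσ  iff  (uσ⁻¹, vσ⁻¹) ∈ A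
actSub : ∀ {r} → Permutation′ r → SubXX r → SubXX r
actSub σ A = tabulate λ u → tabulate λ v → lookup (lookup A (σ ⟨$⟩ˡ u)) (σ ⟨$⟩ˡ v)

-- A family of subsets is given as a list, considered up to reordering (_↭_).
Family : ℕ → Set
Family r = List (SubXX r)

actFam : ∀ {r} → Permutation′ r → Family r → Family r
actFam σ P = map (actSub σ) P

IsPP : ∀ {r} → ℕ → Family r → Set
IsPP k P = length P ≡ k × All NonEmpty P × AllPairs Disjoint P

Fixes : ∀ {r} → Permutation′ r → Family r → Set
Fixes σ P = actFam σ P ↭ P

Semirigid : ∀ {r} → Family r → Set
Semirigid {r} P = (σ : Permutation′ r) → Fixes σ P → All (λ A → actSub σ A ≡ A) P

iter : ∀ {A : Set} → (A → A) → ℕ → A → A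
iter f zero    a = a
iter f (suc n) a = f (iter f n a)

SameOrbit : ∀ {r} → Permutation′ r → Pt r → Pt r → Set
SameOrbit {r} π p q =
  ∃ λ (n : ℕ) → iter (actPt π) n p ≡ q ⊎ iter (λ { (x , y) → (π ⟨$⟩ˡ x , π ⟨$⟩ˡ y) }) n p ≡ q

-- β(π) = b : there is a transversal of the orbits of ⟨π⟩ on X × X of size b
IsOrbitCount : ∀ {r} → Permutation′ r → ℕ → Set
IsOrbitCount {r} π b =
  Σ (List (Pt r)) λ T →
    length T ≡ b
    × AllPairs (λ p q → ¬ SameOrbit π p q) T
    × ((p : Pt r) → Data.List.Relation.Unary.Any.Any (SameOrbit π p) T)
  where import Data.List.Relation.Unary.Any

-- Semirigidity applied to π itself makes every block π-invariant, and a π-invariant subset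
-- of X × X is determined by its trace on a transversal of the β orbits of ⟨π⟩. Restriction
-- to the transversal therefore maps the families in question injectively, up to reordering,
-- to partial partitions of a β-element set into k blocks. Adding one point that collects
-- everything uncovered turns these into partitions of a (β+1)-element set into k+1 blocks,
-- counted by S(β+1, k+1). The recurrence S(n+2, k+1) = (k+1) S(n+1, k+1) + S(n+1, k),
-- split by whether the first point is uncovered, joins one of the k blocks of the others,
-- or forms a block by itself, yields a decoding of Fin S(n+1, k+1) onto the partial
-- partitions of an n-element set into k blocks.
module Submission where

open import Defs
open import Data.Nat using (ℕ; zero; suc; _+_; _*_; _≤_)
open import Data.Nat.Properties using (+-comm)
open import Data.Fin using (Fin; zero; suc; _↑ˡ_; _↑ʳ_; splitAt; combine; remQuot)
open import Data.Fin.Properties using (splitAt-↑ˡ; splitAt-↑ʳ; remQuot-combine; injective⇒≤; any?)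
open import Data.Fin.Permutation using (Permutation′; _⟨$⟩ʳ_; _⟨$⟩ˡ_; inverseˡ)
open import Data.Bool using (Bool; true; false)
import Data.Bool.Properties as Bool
open import Data.Vec using (Vec; []; _∷_; lookup; tabulate; replicate; toList)
import Data.Vec as Vec
open import Data.Vec.Properties using (lookup∘tabulate; tabulate∘lookup; tabulate-cong; toList-map; ≡-dec)
open import Data.Vec.Membership.Propositional using () renaming (_∈_ to _∈ᵥ_)
open import Data.Vec.Membership.Propositional.Properties using (∈-toList⁻)
import Data.Vec.Relation.Unary.Any as VecAny
import Data.Vec.Relation.Unary.Any.Properties as VecAny
open import Data.List using (List; []; _∷_; map; length)
import Data.List as List
open import Data.List.Properties using (length-map; map-cong-local)
open import Data.List.Membership.Propositional using (_∈_)
open import Data.List.Membership.Propositional.Properties using (∈-lookup)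
open import Data.List.Relation.Unary.All using (All; []; _∷_)
import Data.List.Relation.Unary.All as All
import Data.List.Relation.Unary.All.Properties as All
open import Data.List.Relation.Unary.Any using (Any; here)
import Data.List.Relation.Unary.Any as Any
import Data.List.Relation.Unary.Any.Properties as Any
open import Data.List.Relation.Unary.AllPairs using (AllPairs; []; _∷_)
import Data.List.Relation.Unary.AllPairs as AllPairs
import Data.List.Relation.Unary.AllPairs.Properties as AllPairs
open import Data.List.Relation.Unary.Unique.Propositional using (Unique)
open import Data.List.Relation.Binary.Permutation.Propositional
  using (_↭_; ↭-refl; ↭-reflexive; ↭-sym; ↭-trans; ↭-prep; ↭-swap; ↭⇒↭ₛ; module PermutationReasoning)
open import Data.List.Relation.Binary.Permutation.Propositional.Properties using (↭-length; All-resp-↭; ∈-resp-↭)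
import Data.List.Relation.Binary.Permutation.Propositional.Properties as Perm
import Data.List.Relation.Binary.Permutation.Setoid.Properties as PermSetoid
open import Data.Product using (_×_; _,_; proj₁; proj₂; ∃; ∃₂; uncurry)
open import Data.Sum using (_⊎_; inj₁; inj₂; [_,_]′)
open import Data.Empty using (⊥)
open import Function using (_∘_)
open import Function.Definitions using (Injective)
open import Relation.Nullary using (¬_; yes; no; does; contradiction)
open import Relation.Nullary.Decidable using (dec-true; dec-false)
open import Relation.Unary using (Decidable)
open import Relation.Binary.PropositionalEquality
  using (_≡_; _≢_; refl; sym; trans; cong; cong₂; subst; resp₂; setoid; module ≡-Reasoning)

Unique⇒lookup-injective : ∀ {a} {A : Set a} {xs : List A} → Unique xs → Injective _≡_ _≡_ (List.lookup xs)
Unique⇒lookup-injective (_ ∷ _)    {zero}  {zero}  _  = refl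
Unique⇒lookup-injective (x∉xs ∷ _) {zero}  {suc j} eq = contradiction eq (All.lookup x∉xs (∈-lookup j))
Unique⇒lookup-injective (x∉xs ∷ _) {suc i} {zero}  eq = contradiction (sym eq) (All.lookup x∉xs (∈-lookup i))
Unique⇒lookup-injective (_ ∷ xs!)  {suc i} {suc j} eq = cong suc (Unique⇒lookup-injective xs! eq)

Unique⇒length≤ : ∀ {N} {xs : List (Fin N)} → Unique xs → length xs ≤ N
Unique⇒length≤ xs! = injective⇒≤ (Unique⇒lookup-injective xs!)

module _ {a p ℓ} {A : Set a} {P : A → Set p} {_≈_ : A → A → Set ℓ} {N : ℕ}
         (code : ∀ {x} → P x → Fin N)
         (code-injective : ∀ {x y} (px : P x) (py : P y) → code px ≡ code py → x ≈ y) where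

  private
    length-codes : ∀ {xs} (pxs : All P xs) → length (All.reduce code pxs) ≡ length xs
    length-codes []         = refl
    length-codes (_ ∷ pxs) = cong suc (length-codes pxs)

    codes-unique : ∀ {xs} (pxs : All P xs) → AllPairs (λ x y → ¬ x ≈ y) xs → Unique (All.reduce code pxs)
    codes-unique []         []            = []
    codes-unique (px ∷ pxs) (x≉xs ∷ xs≉) = fresh pxs x≉xs ∷ codes-unique pxs xs≉
      where
      fresh : ∀ {ys} (pys : All P ys) → All (λ y → ¬ _ ≈ y) ys → All (code px ≢_) (All.reduce code pys)
      fresh []         []           = []
      fresh (py ∷ pys) (x≉y ∷ x≉ys) = (x≉y ∘ code-injective px py) ∷ fresh pys x≉ys

  length≤-by-code : ∀ {xs} → All P xs → AllPairs (λ x y → ¬ x ≈ y) xs → length xs ≤ N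
  length≤-by-code pxs xs≉ = subst (_≤ N) (length-codes pxs) (Unique⇒length≤ (codes-unique pxs xs≉))

Block : ℕ → Set
Block = Vec Bool

NonEmptyBlock : ∀ {n} → Block n → Set
NonEmptyBlock {n} b = ∃ λ (i : Fin n) → lookup b i ≡ true

DisjointBlocks : ∀ {n} → Block n → Block n → Set
DisjointBlocks {n} b c = (i : Fin n) → lookup b i ≡ true → lookup c i ≡ true → ⊥

IsPartialPartition : ∀ {n} → ℕ → List (Block n) → Set
IsPartialPartition k F = length F ≡ k × All NonEmptyBlock F × AllPairs DisjointBlocks F

nonEmptyBlock? : ∀ {n} → Decidable (NonEmptyBlock {n})
nonEmptyBlock? b = any? (λ i → lookup b i Bool.≟ true)

¬nonEmpty⇒≡replicate : ∀ {n} {b : Block n} → ¬ NonEmptyBlock b → b ≡ replicate n false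
¬nonEmpty⇒≡replicate {b = []}        _     = refl
¬nonEmpty⇒≡replicate {b = true ∷ b}  empty = contradiction (zero , refl) empty
¬nonEmpty⇒≡replicate {b = false ∷ b} empty = cong (false ∷_) (¬nonEmpty⇒≡replicate (λ (i , bᵢ) → empty (suc i , bᵢ)))

nonEmpty-tail : ∀ {n} {b : Block n} → NonEmptyBlock (false ∷ b) → NonEmptyBlock b
nonEmpty-tail (suc i , bᵢ) = i , bᵢ

disjoint-tail : ∀ {n} {a a′} {b c : Block n} → DisjointBlocks (a ∷ b) (a′ ∷ c) → DisjointBlocks b c
disjoint-tail disj = disj ∘ suc

disjoint-sym : ∀ {n} {b c : Block n} → DisjointBlocks b c → DisjointBlocks c b
disjoint-sym disj i cᵢ bᵢ = disj i bᵢ cᵢ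

nonEmpty∧disjoint⇒≢ : ∀ {n} {b c : Block n} → NonEmptyBlock c → DisjointBlocks b c → c ≢ b
nonEmpty∧disjoint⇒≢ (i , cᵢ) disj refl = disj i cᵢ cᵢ

IsPartialPartition-resp-↭ : ∀ {n k} {F G : List (Block n)} → F ↭ G → IsPartialPartition k F → IsPartialPartition k G
IsPartialPartition-resp-↭ {n} F↭G (|F|≡k , nonEmpty , disjoint) =
  trans (sym (↭-length F↭G)) |F|≡k ,
  All-resp-↭ F↭G nonEmpty ,
  PermSetoid.AllPairs-resp-↭ (setoid (Block n)) (λ {b} {c} → disjoint-sym {b = b} {c}) (resp₂ DisjointBlocks) (↭⇒↭ₛ F↭G) disjoint

avoidingZero⁻ : ∀ {n k} {G : List (Block n)} → IsPartialPartition k (map (false ∷_) G) → IsPartialPartition k G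
avoidingZero⁻ {G = G} (|F|≡k , nonEmpty , disjoint) =
  trans (sym (length-map _ G)) |F|≡k ,
  All.map nonEmpty-tail (All.map⁻ nonEmpty) ,
  AllPairs.map disjoint-tail (AllPairs.map⁻ disjoint)

singletonZero : ∀ n → Block (suc n)
singletonZero n = true ∷ replicate n false

adjoinZeroTo : ∀ {n} → Block n → Block n → Block (suc n)
adjoinZeroTo b c = does (≡-dec Bool._≟_ c b) ∷ c

adjoinZeroTo-self : ∀ {n} {b : Block n} → adjoinZeroTo b b ≡ true ∷ b
adjoinZeroTo-self {b = b} = cong (_∷ b) (dec-true (≡-dec Bool._≟_ b b) refl)

adjoinZeroTo-≢ : ∀ {n} {b c : Block n} → c ≢ b → adjoinZeroTo b c ≡ false ∷ c
adjoinZeroTo-≢ {b = b} {c} c≢b = cong (_∷ c) (dec-false (≡-dec Bool._≟_ c b) c≢b)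

data Decomposition {n : ℕ} : ℕ → List (Block (suc n)) → Set where
  avoiding : ∀ {k G} → IsPartialPartition k G → Decomposition k (map (false ∷_) G)
  isolated : ∀ {k G} → IsPartialPartition k G → Decomposition (suc k) (singletonZero n ∷ map (false ∷_) G)
  adjoined : ∀ {k G b} → IsPartialPartition k G → b ∈ G → Decomposition k (map (adjoinZeroTo b) G)

disjointFromZero⇒avoiding : ∀ {n} {b : Block n} {F} → All (DisjointBlocks (true ∷ b)) F → F ≡ map (false ∷_) (map Vec.tail F)
disjointFromZero⇒avoiding {F = []}              []         = refl
disjointFromZero⇒avoiding {F = (true ∷ c) ∷ F}  (disj ∷ _) = contradiction refl (disj zero refl)
disjointFromZero⇒avoiding {F = (false ∷ c) ∷ F} (_ ∷ disj) = cong ((false ∷ c) ∷_) (disjointFromZero⇒avoiding disj)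

locateZero : ∀ {n} {F : List (Block (suc n))} → AllPairs DisjointBlocks F →
  (∃ λ G → F ≡ map (false ∷_) G) ⊎ (∃₂ λ b G → F ↭ (true ∷ b) ∷ map (false ∷_) G)
locateZero {F = []}              []         = inj₁ ([] , refl)
locateZero {F = (true ∷ b) ∷ F}  (disj ∷ _) = inj₂ (b , map Vec.tail F , ↭-reflexive (cong ((true ∷ b) ∷_) (disjointFromZero⇒avoiding disj)))
locateZero {F = (false ∷ c) ∷ F} (_ ∷ disj) with locateZero disj
... | inj₁ (G , refl)   = inj₁ (c ∷ G , refl)
... | inj₂ (b , G , F↭) = inj₂ (b , c ∷ G , ↭-trans (↭-prep _ F↭) (↭-swap _ _ ↭-refl))

decomposeIsolated : ∀ {n k G} → IsPartialPartition k (singletonZero n ∷ map (false ∷_) G) →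
  Decomposition k (singletonZero n ∷ map (false ∷_) G)
decomposeIsolated (refl , _ ∷ nonEmpty , _ ∷ disjoint) = isolated (avoidingZero⁻ (refl , nonEmpty , disjoint))

map-adjoinZeroTo-disjoint : ∀ {n} {b : Block n} {G} → All NonEmptyBlock G → All (DisjointBlocks b) G →
  map (adjoinZeroTo b) G ≡ map (false ∷_) G
map-adjoinZeroTo-disjoint []                      []                = refl
map-adjoinZeroTo-disjoint (c-nonEmpty ∷ nonEmpty) (b∩c=∅ ∷ disjoint) =
  cong₂ _∷_ (adjoinZeroTo-≢ (nonEmpty∧disjoint⇒≢ c-nonEmpty b∩c=∅)) (map-adjoinZeroTo-disjoint nonEmpty disjoint)

decomposeAdjoined : ∀ {n k} {b : Block n} {G} → NonEmptyBlock b → IsPartialPartition k ((true ∷ b) ∷ map (false ∷_) G) →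
  Decomposition k ((true ∷ b) ∷ map (false ∷_) G)
decomposeAdjoined {k = k} {b} {G} b-nonEmpty (|F|≡k , _ ∷ nonEmpty , zeroBlock-disjoint ∷ disjoint) =
  subst (Decomposition k) F≡ (adjoined b∷G-valid (here refl))
  where
  G-valid : IsPartialPartition (length (map (false ∷_) G)) G
  G-valid = avoidingZero⁻ (refl , nonEmpty , disjoint)

  b-disjoint : All (DisjointBlocks b) G
  b-disjoint = All.map disjoint-tail (All.map⁻ zeroBlock-disjoint)

  b∷G-valid : IsPartialPartition k (b ∷ G)
  b∷G-valid = trans (cong suc (proj₁ G-valid)) |F|≡k , b-nonEmpty ∷ proj₁ (proj₂ G-valid) , b-disjoint ∷ proj₂ (proj₂ G-valid)

  F≡ : map (adjoinZeroTo b) (b ∷ G) ≡ (true ∷ b) ∷ map (false ∷_) G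
  F≡ = cong₂ _∷_ adjoinZeroTo-self (map-adjoinZeroTo-disjoint (proj₁ (proj₂ G-valid)) b-disjoint)

decomposeZeroBlock : ∀ {n k} {b : Block n} {G} → IsPartialPartition k ((true ∷ b) ∷ map (false ∷_) G) →
  Decomposition k ((true ∷ b) ∷ map (false ∷_) G)
decomposeZeroBlock {b = b} valid with nonEmptyBlock? b
... | yes b-nonEmpty = decomposeAdjoined b-nonEmpty valid
... | no b-empty with refl ← ¬nonEmpty⇒≡replicate {b = b} b-empty = decomposeIsolated valid

decompose : ∀ {n k} {F : List (Block (suc n))} → IsPartialPartition k F → ∃ λ F′ → F ↭ F′ × Decomposition k F′
decompose valid with locateZero (proj₂ (proj₂ valid))
... | inj₁ (G , refl)   = _ , ↭-refl , avoiding (avoidingZero⁻ valid)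
... | inj₂ (b , G , F↭) = _ , F↭ , decomposeZeroBlock (IsPartialPartition-resp-↭ F↭ valid)

mutual
  decode : ∀ n k → Fin (S (suc n) (suc k)) → Vec (Block n) k
  decode zero    k _ = replicate k []  -- Fin (S 1 (suc k)) is empty unless k = 0
  decode (suc n) k c = [ decodeNotIsolated n k , decodeIsolated n k ]′ (splitAt (suc k * S (suc n) (suc k)) c)

  decodeNotIsolated : ∀ n k → Fin (suc k * S (suc n) (suc k)) → Vec (Block (suc n)) k
  decodeNotIsolated n k c =
    [ Vec.map (false ∷_) ∘ decode n k , uncurry (decodeAdjoined n k) ∘ remQuot (S (suc n) (suc k)) ]′
      (splitAt (S (suc n) (suc k)) c)

  decodeAdjoined : ∀ n k → Fin k → Fin (S (suc n) (suc k)) → Vec (Block (suc n)) k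
  decodeAdjoined n k i c = Vec.map (adjoinZeroTo (lookup (decode n k c) i)) (decode n k c)

  decodeIsolated : ∀ n k → Fin (S (suc n) k) → Vec (Block (suc n)) k
  decodeIsolated n (suc k) c = singletonZero n ∷ Vec.map (false ∷_) (decode n k c)

-- The three summands of S (n+2) (k+1) = S (n+1) (k+1) + k * S (n+1) (k+1) + S (n+1) k.
avoidingCode : ∀ n k → Fin (S (suc n) (suc k)) → Fin (S (suc (suc n)) (suc k))
avoidingCode n k c = (c ↑ˡ k * S (suc n) (suc k)) ↑ˡ S (suc n) k

adjoinedCode : ∀ n k → Fin k → Fin (S (suc n) (suc k)) → Fin (S (suc (suc n)) (suc k))
adjoinedCode n k i c = (S (suc n) (suc k) ↑ʳ combine i c) ↑ˡ S (suc n) k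

isolatedCode : ∀ n k → Fin (S (suc n) (suc k)) → Fin (S (suc (suc n)) (suc (suc k)))
isolatedCode n k c = suc (suc k) * S (suc n) (suc (suc k)) ↑ʳ c

decode-avoidingCode : ∀ {n k} (c : Fin (S (suc n) (suc k))) →
  decode (suc n) k (avoidingCode n k c) ≡ Vec.map (false ∷_) (decode n k c)
decode-avoidingCode {n} {k} c = begin
  decode (suc n) k (avoidingCode n k c)
    ≡⟨ cong [ decodeNotIsolated n k , decodeIsolated n k ]′ (splitAt-↑ˡ (suc k * N) _ (S (suc n) k)) ⟩
  decodeNotIsolated n k (c ↑ˡ k * N)
    ≡⟨ cong [ Vec.map (false ∷_) ∘ decode n k , uncurry (decodeAdjoined n k) ∘ remQuot N ]′ (splitAt-↑ˡ N c (k * N)) ⟩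
  Vec.map (false ∷_) (decode n k c) ∎
  where
  open ≡-Reasoning
  N : ℕ
  N = S (suc n) (suc k)

decode-adjoinedCode : ∀ {n k} (i : Fin k) (c : Fin (S (suc n) (suc k))) →
  decode (suc n) k (adjoinedCode n k i c) ≡ decodeAdjoined n k i c
decode-adjoinedCode {n} {k} i c = begin
  decode (suc n) k (adjoinedCode n k i c)
    ≡⟨ cong [ decodeNotIsolated n k , decodeIsolated n k ]′ (splitAt-↑ˡ (suc k * N) _ (S (suc n) k)) ⟩
  decodeNotIsolated n k (N ↑ʳ combine i c)
    ≡⟨ cong [ Vec.map (false ∷_) ∘ decode n k , uncurry (decodeAdjoined n k) ∘ remQuot N ]′ (splitAt-↑ʳ N (k * N) (combine i c)) ⟩
  uncurry (decodeAdjoined n k) (remQuot N (combine i c))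
    ≡⟨ cong (uncurry (decodeAdjoined n k)) (remQuot-combine i c) ⟩
  decodeAdjoined n k i c ∎
  where
  open ≡-Reasoning
  N : ℕ
  N = S (suc n) (suc k)

decode-isolatedCode : ∀ {n k} (c : Fin (S (suc n) (suc k))) →
  decode (suc n) (suc k) (isolatedCode n k c) ≡ singletonZero n ∷ Vec.map (false ∷_) (decode n k c)
decode-isolatedCode {n} {k} c =
  cong [ decodeNotIsolated n (suc k) , decodeIsolated n (suc k) ]′ (splitAt-↑ʳ (suc (suc k) * S (suc n) (suc (suc k))) _ c)

↭-map-toList : ∀ {A B : Set} {m} (f : A → B) {G : List A} {d : Vec A m} → G ↭ toList d → map f G ↭ toList (Vec.map f d)
↭-map-toList f {d = d} G↭d = ↭-trans (Perm.map⁺ f G↭d) (↭-reflexive (sym (toList-map f d)))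

decode-surjective : ∀ {n k} {F : List (Block n)} → IsPartialPartition k F → ∃ λ c → F ↭ toList (decode n k c)
decode-surjective {zero} {zero}  {F = []}    _ = zero , ↭-refl
decode-surjective {zero} {suc _} {F = []}    (() , _)
decode-surjective {zero}         {F = _ ∷ _} (_ , (() , _) ∷ _ , _)
decode-surjective {suc n} {k} {F} valid with decompose valid
... | _ , F↭ , avoiding {G = G} G-valid with c , G↭ ← decode-surjective G-valid =
  avoidingCode n k c , (begin
    F                                              ↭⟨ F↭ ⟩
    map (false ∷_) G                               ↭⟨ ↭-map-toList (false ∷_) G↭ ⟩
    toList (Vec.map (false ∷_) (decode n k c))     ≡⟨ cong toList (decode-avoidingCode c) ⟨
    toList (decode (suc n) k (avoidingCode n k c)) ∎)
  where open PermutationReasoning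
... | _ , F↭ , isolated {k = k′} {G = G} G-valid with c , G↭ ← decode-surjective G-valid =
  isolatedCode n k′ c , (begin
    F                                                             ↭⟨ F↭ ⟩
    singletonZero n ∷ map (false ∷_) G                            ↭⟨ ↭-prep _ (↭-map-toList (false ∷_) G↭) ⟩
    singletonZero n ∷ toList (Vec.map (false ∷_) (decode n k′ c)) ≡⟨ cong toList (decode-isolatedCode c) ⟨
    toList (decode (suc n) (suc k′) (isolatedCode n k′ c))        ∎)
  where open PermutationReasoning
... | _ , F↭ , adjoined {G = G} {b} G-valid b∈G with c , G↭ ← decode-surjective G-valid =
  adjoinedCode n k i c , (begin
    F                                                ↭⟨ F↭ ⟩
    map (adjoinZeroTo b) G                           ↭⟨ ↭-map-toList (adjoinZeroTo b) G↭ ⟩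
    toList (Vec.map (adjoinZeroTo b) (decode n k c)) ≡⟨ cong (λ b′ → toList (Vec.map (adjoinZeroTo b′) (decode n k c))) b≡dᵢ ⟩
    toList (decodeAdjoined n k i c)                  ≡⟨ cong toList (decode-adjoinedCode i c) ⟨
    toList (decode (suc n) k (adjoinedCode n k i c)) ∎)
  where
  open PermutationReasoning
  b∈d : b ∈ᵥ decode n k c
  b∈d = ∈-toList⁻ (∈-resp-↭ G↭ b∈G)

  i : Fin k
  i = VecAny.index b∈d

  b≡dᵢ : b ≡ lookup (decode n k c) i
  b≡dᵢ = VecAny.lookup-index b∈d

partialPartitionCode : ∀ {n k} {F : List (Block n)} → IsPartialPartition k F → Fin (S (suc n) (suc k))
partialPartitionCode valid = proj₁ (decode-surjective valid)

partialPartitionCode-injective : ∀ {n k} {F G : List (Block n)} (F-valid : IsPartialPartition k F) (G-valid : IsPartialPartition k G) →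
  partialPartitionCode F-valid ≡ partialPartitionCode G-valid → F ↭ G
partialPartitionCode-injective {n} {k} F-valid G-valid same-code =
  ↭-trans (proj₂ (decode-surjective F-valid))
    (subst (λ c → toList (decode n k c) ↭ _) (sym same-code) (↭-sym (proj₂ (decode-surjective G-valid))))

iter-invariant : ∀ {A B : Set} {f : A → B} {g : A → A} → (∀ a → f (g a) ≡ f a) → ∀ n a → f (iter g n a) ≡ f a
iter-invariant f∘g≡f zero    a = refl
iter-invariant f∘g≡f (suc n) a = trans (f∘g≡f _) (iter-invariant f∘g≡f n a)

member : ∀ {r} → SubXX r → Pt r → Bool
member A (x , y) = lookup (lookup A x) y

member-actSub : ∀ {r} (σ : Permutation′ r) A u v → member (actSub σ A) (u , v) ≡ member A (σ ⟨$⟩ˡ u , σ ⟨$⟩ˡ v)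
member-actSub {r} σ A u v = begin
  lookup (lookup (tabulate row) u) v ≡⟨ cong (λ xs → lookup xs v) (lookup∘tabulate row u) ⟩
  lookup (row u) v                   ≡⟨ lookup∘tabulate _ v ⟩
  member A (σ ⟨$⟩ˡ u , σ ⟨$⟩ˡ v)     ∎
  where
  open ≡-Reasoning
  row : Fin r → Vec Bool r
  row u = tabulate λ v → lookup (lookup A (σ ⟨$⟩ˡ u)) (σ ⟨$⟩ˡ v)

module _ {r} (π : Permutation′ r) where

  Invariant : SubXX r → Set
  Invariant A = actSub π A ≡ A

  member-invariantˡ : ∀ {A} → Invariant A → ∀ u v → member A (π ⟨$⟩ˡ u , π ⟨$⟩ˡ v) ≡ member A (u , v)
  member-invariantˡ {A} A-invariant u v = trans (sym (member-actSub π A u v)) (cong (λ B → member B (u , v)) A-invariant)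

  member-invariantʳ : ∀ {A} → Invariant A → ∀ x y → member A (π ⟨$⟩ʳ x , π ⟨$⟩ʳ y) ≡ member A (x , y)
  member-invariantʳ {A} A-invariant x y = begin
    member A (π ⟨$⟩ʳ x , π ⟨$⟩ʳ y)                               ≡⟨ member-invariantˡ A-invariant _ _ ⟨
    member A (π ⟨$⟩ˡ (π ⟨$⟩ʳ x) , π ⟨$⟩ˡ (π ⟨$⟩ʳ y))             ≡⟨ cong₂ (λ u v → member A (u , v)) (inverseˡ π) (inverseˡ π) ⟩
    member A (x , y)                                             ∎
    where open ≡-Reasoning

  member-constant-on-orbits : ∀ {A} → Invariant A → ∀ {p q} → SameOrbit π p q → member A q ≡ member A p
  member-constant-on-orbits {A} A-invariant {p} (n , inj₁ πⁿp≡q) =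
    trans (cong (member A) (sym πⁿp≡q)) (iter-invariant (λ (x , y) → member-invariantʳ A-invariant x y) n p)
  member-constant-on-orbits {A} A-invariant {p} (n , inj₂ π⁻ⁿp≡q) =
    trans (cong (member A) (sym π⁻ⁿp≡q)) (iter-invariant (λ (u , v) → member-invariantˡ A-invariant u v) n p)

  module Transversal (T : List (Pt r)) (cover : ∀ p → Any (SameOrbit π p) T) where

    restrict : SubXX r → Block (length T)
    restrict A = tabulate (member A ∘ List.lookup T)

    extend : Block (length T) → SubXX r
    extend b = tabulate λ x → tabulate λ y → lookup b (Any.index (cover (x , y)))

    lookup-restrict : ∀ {A} → Invariant A → ∀ p → lookup (restrict A) (Any.index (cover p)) ≡ member A p
    lookup-restrict {A} A-invariant p =
      trans (lookup∘tabulate (member A ∘ List.lookup T) _) (member-constant-on-orbits A-invariant (Any.lookup-index (cover p)))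

    extend-restrict : ∀ {A} → Invariant A → extend (restrict A) ≡ A
    extend-restrict {A} A-invariant =
      trans (tabulate-cong λ x → trans (tabulate-cong λ y → lookup-restrict A-invariant (x , y)) (tabulate∘lookup _))
            (tabulate∘lookup A)

    restrict-reflects-↭ : ∀ {P Q} → All Invariant P → All Invariant Q → map restrict P ↭ map restrict Q → P ↭ Q
    restrict-reflects-↭ {P} {Q} P-invariant Q-invariant P↭Q = begin
      P                              ≡⟨ extend∘restrict P-invariant ⟨
      map extend (map restrict P)    ↭⟨ Perm.map⁺ extend P↭Q ⟩
      map extend (map restrict Q)    ≡⟨ extend∘restrict Q-invariant ⟩
      Q                              ∎
      where
      open PermutationReasoning
      extend∘restrict : ∀ {P} → All Invariant P → map extend (map restrict P) ≡ P
      extend∘restrict []                          = refl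
      extend∘restrict (A-invariant ∷ P-invariant) = cong₂ _∷_ (extend-restrict A-invariant) (extend∘restrict P-invariant)

    restrict-nonEmpty : ∀ {A} → Invariant A → NonEmpty A → NonEmptyBlock (restrict A)
    restrict-nonEmpty A-invariant (p , p∈A) = Any.index (cover p) , trans (lookup-restrict A-invariant p) p∈A

    restrict-disjoint : ∀ {A B} → Disjoint A B → DisjointBlocks (restrict A) (restrict B)
    restrict-disjoint A∩B=∅ i Aᵢ Bᵢ =
      A∩B=∅ (List.lookup T i) (trans (sym (lookup∘tabulate _ i)) Aᵢ) (trans (sym (lookup∘tabulate _ i)) Bᵢ)

    restrict-isPartialPartition : ∀ {k P} → All Invariant P → IsPP k P → IsPartialPartition k (map restrict P)
    restrict-isPartialPartition {P = P} P-invariant (|P|≡k , nonEmpty , disjoint) =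
      trans (length-map restrict P) |P|≡k ,
      All.map⁺ (All.zipWith (uncurry restrict-nonEmpty) (P-invariant , nonEmpty)) ,
      AllPairs.map⁺ (AllPairs.map (λ {A} {B} → restrict-disjoint {A} {B}) disjoint)

lemma6p3 : (r k : ℕ) → 1 ≤ k → (π : Permutation′ r) → (β : ℕ) → IsOrbitCount π β →
    (L : List (Family r)) → AllPairs (λ P Q → ¬ (P ↭ Q)) L →
    All (λ P → IsPP k P × Fixes π P × Semirigid P) L →
    length L ≤ S (β + 1) (k + 1)
lemma6p3 r k _ π β (T , |T|≡β , _ , cover) L distinct admissible =
  subst (length L ≤_) (cong₂ S (trans (cong suc |T|≡β) (+-comm 1 β)) (+-comm 1 k))
    (length≤-by-code code code-injective admissible distinct)
  where
  open Transversal π T cover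

  Admissible : Family r → Set
  Admissible P = IsPP k P × Fixes π P × Semirigid P

  blocks-invariant : ∀ {P} → Admissible P → All (Invariant π) P
  blocks-invariant (_ , fixed , semirigid) = semirigid π fixed

  code : ∀ {P} → Admissible P → Fin (S (suc (length T)) (suc k))
  code P-admissible = partialPartitionCode (restrict-isPartialPartition (blocks-invariant P-admissible) (proj₁ P-admissible))

  code-injective : ∀ {P Q} (P-admissible : Admissible P) (Q-admissible : Admissible Q) → code P-admissible ≡ code Q-admissible → P ↭ Q
  code-injective P-admissible Q-admissible same-code =
    restrict-reflects-↭ (blocks-invariant P-admissible) (blocks-invariant Q-admissible) (partialPartitionCode-injective _ _ same-code)
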